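{- The colouring procedure (described in the context), run on an Eulerian directed multigraph, terminates.
   Context: $G=(V,E)$ is a finite directed multigraph (loops and parallel edges allowed), Eulerian: strongly connected and every vertex has in-degree equal to out-degree. Colouring procedure: each edge has a colour in $\{\textsc{Black},\textsc{Red},\textsc{Green},\textsc{Dashed}\}$, initially all \textsc{Black}. Choose a start vertex $v_0$; the current vertex is $u=v_0$, and $v_0$ is marked reached. Repeat: if some \textsc{Black} edge $wu$ enters the current vertex $u$, pick one, colour it \textsc{Red} if $w$ was not yet reached (and mark $w$ reached), otherwise \textsc{Green}, and make $w$ current. Otherwise: if some \textsc{Green} edge $uw$ leaves $u$, colour it \textsc{Dashed}, output it, make $w$ current; else if $u\ne v_0$, colour the unique \textsc{Red} edge $uw$ leaving $u$ \textsc{Dashed}, output it, make $w$ current; else ($u=v_0$) terminate. -}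

module Defs where

open import Data.Nat using (ℕ)
open import Data.Fin using (Fin; _≟_)
open import Data.Bool using (Bool; true; false; if_then_else_)
open import Data.List using (List; length; filter; allFin)
open import Data.Product using (Σ; ∃; _,_)
open import Data.Sum using (_⊎_)
open import Relation.Nullary using (¬_; does)
open import Relation.Binary.PropositionalEquality using (_≡_; _≢_)

record Multigraph : Set where
  field
    n   : ℕ
    m   : ℕ
    src : Fin m → Fin n
    tgt : Fin m → Fin n

module _ (G : Multigraph) where
  open Multigraph G

  data Walk : Fin n → Fin n → Set where
    [] : ∀ {x} → Walk x x
    _∷_ : ∀ {y} (e : Fin m) → Walk (tgt e) y → Walk (src e) y

  StronglyConnected : Set
  StronglyConnected = ∀ x y → Walk x y

  inDeg outDeg : Fin n → ℕ
  inDeg v  = length (filter (λ e → tgt e ≟ v) (allFin m))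
  outDeg v = length (filter (λ e → src e ≟ v) (allFin m))

  Eulerian : Set
  Eulerian = StronglyConnected × (∀ v → inDeg v ≡ outDeg v)
    where open import Data.Product using (_×_)

data Colour : Set where
  black red green dashed : Colour

update : ∀ {k} {A : Set} → (Fin k → A) → Fin k → A → Fin k → A
update f i a j = if does (j ≟ i) then a else f j

module Procedure (G : Multigraph) (v₀ : Fin (Multigraph.n G)) where
  open Multigraph G

  record State : Set where
    constructor st
    field
      cur     : Fin n
      colour  : Fin m → Colour
      reached : Fin n → Bool
  open State

  initial : State
  initial = st v₀ (λ _ → black) (update (λ _ → false) v₀ true)

  NoBlackIn : State → Set
  NoBlackIn s = ∀ e → tgt e ≡ cur s → colour s e ≢ black

  NoGreenOut : State → Set
  NoGreenOut s = ∀ e → src e ≡ cur s → colour s e ≢ green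

  data _⟶_ : State → State → Set where
    blackRed : ∀ {s} e → tgt e ≡ cur s → colour s e ≡ black → reached s (src e) ≡ false →
      s ⟶ st (src e) (update (colour s) e red) (update (reached s) (src e) true)
    blackGreen : ∀ {s} e → tgt e ≡ cur s → colour s e ≡ black → reached s (src e) ≡ true →
      s ⟶ st (src e) (update (colour s) e green) (reached s)
    greenOut : ∀ {s} e → NoBlackIn s → src e ≡ cur s → colour s e ≡ green →
      s ⟶ st (tgt e) (update (colour s) e dashed) (reached s)
    redOut : ∀ {s} e → NoBlackIn s → NoGreenOut s → cur s ≢ v₀ →
      src e ≡ cur s → colour s e ≡ red →
      s ⟶ st (tgt e) (update (colour s) e dashed) (reached s)

  Final : State → Set
  Final s = cur s ≡ v₀ × NoBlackIn s × NoGreenOut s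
    where open import Data.Product using (_×_)

  -- every run from s ends (in finitely many steps) by the termination branch:
  -- either s terminates now, or some step is possible and every possible
  -- step leads to a state from which every run terminates.
  data Terminates (s : State) : Set where
    done : Final s → Terminates s
    step : (∃ λ s' → s ⟶ s') → (∀ s' → s ⟶ s' → Terminates s') → Terminates s

{-# OPTIONS --safe #-}
-- Every step recolours one edge downwards in the order Black > Red, Green > Dashed,
-- so the total weight with Black = 2, Red = Green = 1, Dashed = 0 strictly decreases.
-- The procedure never gets stuck because the Red and Green edges, traversed backwards,
-- form a trail from v₀ to the current vertex u: the trail degrees balance at every
-- vertex except v₀ and u. Hence if u ≠ v₀, some trail edge leaves u, and when no
-- Green edge leaves u that edge is Red.
module Submission where

open import Defs
open import Data.Bool using (Bool; true; false; if_then_else_)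
open import Data.Empty using (⊥-elim)
open import Data.Fin using (Fin; zero; suc; _≟_; punchIn)
open import Data.Fin.Properties using (any?; punchInᵢ≢i)
import Data.Nat as ℕ
open import Data.Nat using (ℕ; _+_; _<_)
open import Data.Nat.Induction using (<-wellFounded)
open import Data.Nat.Properties
  using (+-0-commutativeMonoid; +-commutativeSemigroup; +-identityʳ; +-suc; +-cancelʳ-≡; ≤-reflexive; m+1+n≢0)
open import Algebra.Properties.CommutativeMonoid.Sum +-0-commutativeMonoid
  using (sum; sum-syntax; sum-remove; sum-cong-≗)
open import Algebra.Properties.CommutativeSemigroup +-commutativeSemigroup
  using (xy∙z≈zy∙x; xy∙z≈xz∙y)
open import Data.Product using (∃; _×_; _,_)
open import Data.Sum using (_⊎_; inj₁; inj₂)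
open import Function using (_∘_)
open import Induction.WellFounded using (Acc; acc)
open import Relation.Nullary using (Dec; yes; no; does)
open import Relation.Nullary.Decidable using (_×-dec_; dec-true; dec-false)
open import Relation.Binary.PropositionalEquality
  using (_≡_; _≢_; refl; sym; trans; cong; cong₂; module ≡-Reasoning)
open ≡-Reasoning

update-same : ∀ {k} {A : Set} (f : Fin k → A) i a → update f i a i ≡ a
update-same f i a rewrite dec-true (i ≟ i) refl = refl

update-other : ∀ {k} {A : Set} (f : Fin k → A) i a {j} → j ≢ i → update f i a j ≡ f j
update-other f i a {j} j≢i rewrite dec-false (j ≟ i) j≢i = refl

∑-update : ∀ {k} {A : Set} (w : Fin k → A → ℕ) (f : Fin k → A) i a →
           ∑[ j < k ] w j (update f i a j) + w i (f i) ≡ ∑[ j < k ] w j (f j) + w i a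
∑-update {ℕ.suc k} w f i a = begin
  sum w′ + w i (f i)                              ≡⟨ cong (_+ w i (f i)) (sum-remove {i = i} w′) ⟩
  w′ i + ∑[ j < k ] w′ (punchIn i j) + w i (f i)  ≡⟨ cong₂ (λ x y → x + y + w i (f i))
                                                       (cong (w i) (update-same f i a)) (sum-cong-≗ unchanged) ⟩
  w i a + ∑[ j < k ] w₀ (punchIn i j) + w i (f i) ≡⟨ xy∙z≈zy∙x (w i a) _ (w i (f i)) ⟩
  w i (f i) + ∑[ j < k ] w₀ (punchIn i j) + w i a ≡⟨ cong (_+ w i a) (sum-remove {i = i} w₀) ⟨
  sum w₀ + w i a                                  ∎
  where
  w′ w₀ : Fin (ℕ.suc k) → ℕ
  w′ j = w j (update f i a j)
  w₀ j = w j (f j)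
  unchanged : ∀ j → w′ (punchIn i j) ≡ w₀ (punchIn i j)
  unchanged j = cong (w (punchIn i j)) (update-other f i a (punchInᵢ≢i i j))

∑≢0⇒∃≢0 : ∀ {k} (t : Fin k → ℕ) → ∑[ j < k ] t j ≢ 0 → ∃ λ j → t j ≢ 0
∑≢0⇒∃≢0 {ℕ.zero}  t ∑≢0 = ⊥-elim (∑≢0 refl)
∑≢0⇒∃≢0 {ℕ.suc k} t ∑≢0 with t zero ℕ.≟ 0
... | no t₀≢0 = zero , t₀≢0
... | yes t₀≡0 with ∑≢0⇒∃≢0 (t ∘ suc) (∑≢0 ∘ cong₂ _+_ t₀≡0)
...   | j , tⱼ≢0 = suc j , tⱼ≢0

m+1+k≡n+k⇒m<n : ∀ m n k → m + ℕ.suc k ≡ n + k → m < n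
m+1+k≡n+k⇒m<n m n k eq = ≤-reflexive (+-cancelʳ-≡ k (ℕ.suc m) n (trans (sym (+-suc m k)) eq))

δ : ∀ {n} → Fin n → Fin n → ℕ
δ x y = if does (x ≟ y) then 1 else 0

δ-refl : ∀ {n} (x : Fin n) → δ x x ≡ 1
δ-refl x rewrite dec-true (x ≟ x) refl = refl

δ-≢ : ∀ {n} {x y : Fin n} → x ≢ y → δ x y ≡ 0
δ-≢ {x = x} {y} x≢y rewrite dec-false (x ≟ y) x≢y = refl

δ≢0⇒≡ : ∀ {n} {x y : Fin n} → δ x y ≢ 0 → x ≡ y
δ≢0⇒≡ {x = x} {y} δ≢0 with x ≟ y
... | yes x≡y = x≡y
... | no _    = ⊥-elim (δ≢0 refl)

onTrail : Colour → Bool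
onTrail red   = true
onTrail green = true
onTrail _     = false

weight : Colour → ℕ
weight black  = 2
weight red    = 1
weight green  = 1
weight dashed = 0

onTrail⇒weight≡1 : ∀ {c} → onTrail c ≡ true → weight c ≡ 1
onTrail⇒weight≡1 {red}   _ = refl
onTrail⇒weight≡1 {green} _ = refl

black? : (c : Colour) → Dec (c ≡ black)
black? black  = yes refl
black? red    = no λ ()
black? green  = no λ ()
black? dashed = no λ ()

green? : (c : Colour) → Dec (c ≡ green)
green? black  = no λ ()
green? red    = no λ ()
green? green  = yes refl
green? dashed = no λ ()

module _ (G : Multigraph) (v₀ : Fin (Multigraph.n G)) where
  open Multigraph G
  open Procedure G v₀
  open State

  trailIncidence : (Fin m → Fin n) → Fin n → Fin m → Colour → ℕ
  trailIncidence end v e c = if onTrail c then δ (end e) v else 0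

  trailDegree : (Fin m → Fin n) → (Fin m → Colour) → Fin n → ℕ
  trailDegree end c v = ∑[ e < m ] trailIncidence end v e (c e)

  module _ (end : Fin m → Fin n) (c : Fin m → Colour) (e : Fin m) (v : Fin n) where

    trailDegree-push : ∀ {a} → c e ≡ black → onTrail a ≡ true →
                       trailDegree end (update c e a) v ≡ trailDegree end c v + δ (end e) v
    trailDegree-push {a} isBlack onA = begin
      d′               ≡⟨ +-identityʳ d′ ⟨
      d′ + 0           ≡⟨ cong (λ c′ → d′ + w e c′) isBlack ⟨
      d′ + w e (c e)   ≡⟨ ∑-update w c e a ⟩
      d + w e a        ≡⟨ cong (λ b → d + (if b then δ (end e) v else 0)) onA ⟩
      d + δ (end e) v  ∎
      where
      w : Fin m → Colour → ℕ
      w = trailIncidence end v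
      d d′ : ℕ
      d  = trailDegree end c v
      d′ = trailDegree end (update c e a) v

    trailDegree-pop : onTrail (c e) ≡ true →
                      trailDegree end c v ≡ trailDegree end (update c e dashed) v + δ (end e) v
    trailDegree-pop onCe = begin
      d                ≡⟨ +-identityʳ d ⟨
      d + 0            ≡⟨ ∑-update w c e dashed ⟨
      d′ + w e (c e)   ≡⟨ cong (λ b → d′ + (if b then δ (end e) v else 0)) onCe ⟩
      d′ + δ (end e) v ∎
      where
      w : Fin m → Colour → ℕ
      w = trailIncidence end v
      d d′ : ℕ
      d  = trailDegree end c v
      d′ = trailDegree end (update c e dashed) v

  TrailBalanced : State → Set
  TrailBalanced s = ∀ v → trailDegree src (colour s) v + δ v₀ v ≡ trailDegree tgt (colour s) v + δ (cur s) v

  data Move (s : State) : State → Set where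
    push : ∀ e {a r} → tgt e ≡ cur s → colour s e ≡ black → onTrail a ≡ true →
           Move s (st (src e) (update (colour s) e a) r)
    pop  : ∀ e {r} → src e ≡ cur s → onTrail (colour s e) ≡ true →
           Move s (st (tgt e) (update (colour s) e dashed) r)

  move : ∀ {s s′} → s ⟶ s′ → Move s s′
  move (blackRed e into isBlack _)   = push e into isBlack refl
  move (blackGreen e into isBlack _) = push e into isBlack refl
  move (greenOut e _ from isGreen)   = pop e from (cong onTrail isGreen)
  move (redOut e _ _ _ from isRed)   = pop e from (cong onTrail isRed)

  move-balanced : ∀ {s s′} → Move s s′ → TrailBalanced s → TrailBalanced s′
  move-balanced {st u c _} (push e {a} into isBlack onA) bal v = begin
    d⁺′ + δ v₀ v                    ≡⟨ cong (_+ δ v₀ v) (trailDegree-push src c e v isBlack onA) ⟩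
    d⁺ + δ (src e) v + δ v₀ v       ≡⟨ xy∙z≈xz∙y d⁺ (δ (src e) v) (δ v₀ v) ⟩
    d⁺ + δ v₀ v + δ (src e) v       ≡⟨ cong (_+ δ (src e) v) (bal v) ⟩
    d⁻ + δ u v + δ (src e) v        ≡⟨ cong (λ x → d⁻ + δ x v + δ (src e) v) into ⟨
    d⁻ + δ (tgt e) v + δ (src e) v  ≡⟨ cong (_+ δ (src e) v) (trailDegree-push tgt c e v isBlack onA) ⟨
    d⁻′ + δ (src e) v               ∎
    where
    d⁺ d⁻ d⁺′ d⁻′ : ℕ
    d⁺  = trailDegree src c v
    d⁻  = trailDegree tgt c v
    d⁺′ = trailDegree src (update c e a) v
    d⁻′ = trailDegree tgt (update c e a) v
  move-balanced {st u c _} (pop e from onCe) bal v = +-cancelʳ-≡ (δ u v) _ _ (begin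
    d⁺′ + δ v₀ v + δ u v            ≡⟨ xy∙z≈xz∙y d⁺′ (δ v₀ v) (δ u v) ⟩
    d⁺′ + δ u v + δ v₀ v            ≡⟨ cong (λ x → d⁺′ + δ x v + δ v₀ v) from ⟨
    d⁺′ + δ (src e) v + δ v₀ v      ≡⟨ cong (_+ δ v₀ v) (trailDegree-pop src c e v onCe) ⟨
    d⁺ + δ v₀ v                     ≡⟨ bal v ⟩
    d⁻ + δ u v                      ≡⟨ cong (_+ δ u v) (trailDegree-pop tgt c e v onCe) ⟩
    d⁻′ + δ (tgt e) v + δ u v       ∎)
    where
    d⁺ d⁻ d⁺′ d⁻′ : ℕ
    d⁺  = trailDegree src c v
    d⁻  = trailDegree tgt c v
    d⁺′ = trailDegree src (update c e dashed) v
    d⁻′ = trailDegree tgt (update c e dashed) v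

  potential : (Fin m → Colour) → ℕ
  potential c = ∑[ e < m ] weight (c e)

  move-decreases : ∀ {s s′} → Move s s′ → potential (colour s′) < potential (colour s)
  move-decreases {st _ c _} (push e {a} _ isBlack onA) = m+1+k≡n+k⇒m<n p′ p 1 (begin
    p′ + 2            ≡⟨ cong ((p′ +_) ∘ weight) isBlack ⟨
    p′ + weight (c e) ≡⟨ ∑-update (λ _ → weight) c e a ⟩
    p + weight a      ≡⟨ cong (p +_) (onTrail⇒weight≡1 onA) ⟩
    p + 1             ∎)
    where
    p p′ : ℕ
    p  = potential c
    p′ = potential (update c e a)
  move-decreases {st _ c _} (pop e _ onCe) = m+1+k≡n+k⇒m<n p′ p 0 (begin
    p′ + 1            ≡⟨ cong (p′ +_) (onTrail⇒weight≡1 onCe) ⟨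
    p′ + weight (c e) ≡⟨ ∑-update (λ _ → weight) c e dashed ⟩
    p + 0             ∎)
    where
    p p′ : ℕ
    p  = potential c
    p′ = potential (update c e dashed)

  red-leaves-cur : ∀ s → TrailBalanced s → cur s ≢ v₀ → NoGreenOut s →
                   ∃ λ e → src e ≡ cur s × colour s e ≡ red
  red-leaves-cur s bal away noGreen
    with ∑≢0⇒∃≢0 (λ e → trailIncidence src (cur s) e (colour s e)) d⁺≢0
    where
    d⁺ d⁻ : ℕ
    d⁺ = trailDegree src (colour s) (cur s)
    d⁻ = trailDegree tgt (colour s) (cur s)
    d⁺≢0 : d⁺ ≢ 0
    d⁺≢0 d⁺≡0 = m+1+n≢0 d⁻ (begin
      d⁻ + 1                 ≡⟨ cong (d⁻ +_) (δ-refl (cur s)) ⟨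
      d⁻ + δ (cur s) (cur s) ≡⟨ bal (cur s) ⟨
      d⁺ + δ v₀ (cur s)      ≡⟨ cong₂ _+_ d⁺≡0 (δ-≢ (away ∘ sym)) ⟩
      0                      ∎)
  ... | e , incident with colour s e in isColour
  ...   | red    = e , δ≢0⇒≡ incident , isColour
  ...   | green  = ⊥-elim (noGreen e (δ≢0⇒≡ incident) isColour)
  ...   | black  = ⊥-elim (incident refl)
  ...   | dashed = ⊥-elim (incident refl)

  black-in-step : ∀ s e → tgt e ≡ cur s → colour s e ≡ black → ∃ λ s′ → s ⟶ s′
  black-in-step s e into isBlack with reached s (src e) in isReached
  ... | true  = _ , blackGreen e into isBlack isReached
  ... | false = _ , blackRed e into isBlack isReached

  black-in? : ∀ s → (∃ λ e → tgt e ≡ cur s × colour s e ≡ black) ⊎ NoBlackIn s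
  black-in? s with any? (λ e → tgt e ≟ cur s ×-dec black? (colour s e))
  ... | yes found = inj₁ found
  ... | no none   = inj₂ λ e into isBlack → none (e , into , isBlack)

  green-out? : ∀ s → (∃ λ e → src e ≡ cur s × colour s e ≡ green) ⊎ NoGreenOut s
  green-out? s with any? (λ e → src e ≟ cur s ×-dec green? (colour s e))
  ... | yes found = inj₁ found
  ... | no none   = inj₂ λ e from isGreen → none (e , from , isGreen)

  progress : ∀ s → TrailBalanced s → Final s ⊎ ∃ λ s′ → s ⟶ s′
  progress s bal with black-in? s | green-out? s | cur s ≟ v₀
  ... | inj₁ (e , into , isBlack) | _                         | _           = inj₂ (black-in-step s e into isBlack)
  ... | inj₂ noBlack              | inj₁ (e , from , isGreen) | _           = inj₂ (_ , greenOut e noBlack from isGreen)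
  ... | inj₂ noBlack              | inj₂ noGreen              | yes atStart = inj₁ (atStart , noBlack , noGreen)
  ... | inj₂ noBlack              | inj₂ noGreen              | no away
    with red-leaves-cur s bal away noGreen
  ...   | e , from , isRed = inj₂ (_ , redOut e noBlack noGreen away from isRed)

  terminates : ∀ s → TrailBalanced s → Acc _<_ (potential (colour s)) → Terminates s
  terminates s bal (acc smaller) with progress s bal
  ... | inj₁ final = done final
  ... | inj₂ next  = step next λ s′ s⟶s′ →
    terminates s′ (move-balanced (move s⟶s′) bal) (smaller (move-decreases (move s⟶s′)))

  initial-balanced : TrailBalanced initial
  initial-balanced _ = refl

-- Termination does not need G to be Eulerian.
lemma6 : (G : Multigraph) → Eulerian G → (v₀ : Fin (Multigraph.n G)) →
    Procedure.Terminates G v₀ (Procedure.initial G v₀)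
lemma6 G _ v₀ = terminates G v₀ (Procedure.initial G v₀) (initial-balanced G v₀) (<-wellFounded _)
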